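{- $\overrightarrow{\nu}(K_3)=2$, $\overrightarrow{\nu}(N_4)\geq 2$, $\overrightarrow{\nu}(M_5)\geq 2$, $\overrightarrow{\nu}(\overleftarrow{N_4})\geq 2$, and $\overrightarrow{\nu}(\overleftarrow{M_5})\geq 2$.
   Context: For a digraph $D$ with vertex set $\{1,\dots,n\}$, $Q(D)$ is the set of real $n\times n$ matrices $B=[b_{u,w}]$ with $b_{u,u}\neq 0$ for all $u$, $b_{u,w}\neq 0$ if $u\neq w$ and there is an arc from $u$ to $w$, and $b_{u,w}=0$ if $u\neq w$ and there is no arc from $u$ to $w$. A matrix $B\in Q(D)$ has the Asymmetric Strong Arnold Property (ASAP) if the only real $n\times n$ matrix $X$ with $X\circ B=0$ (entrywise product), $X^TB=0$ and $BX^T=0$ is $X=0$. $\overrightarrow{\nu}(D)$ is the largest nullity of a matrix $B\in Q(D)$ having the ASAP. $\overleftarrow{D}$ is $D$ with all arcs reversed. $K_3$ is the digraph on three vertices with an arc in each direction between every pair of distinct vertices. $N_4$ has vertex set $\{a,b,c,d\}$ and arcs $ab,ba,bc,cb,cd,dc,ac,db$; $M_5$ has vertex set $\{a,b,c,d,e\}$ and arcs $ab,ba,bc,cb,cd,dc,de,ed,ac,ec$ (here $vw$ is the arc from $v$ to $w$). -}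

module Defs where

open import Level using (0ℓ)
open import Data.Nat using (ℕ; zero; suc)
open import Data.Fin using (Fin; zero; suc)
open import Data.Bool using (Bool; true; false)
open import Data.Product using (Σ; ∃; _×_; _,_)
open import Data.Empty using (⊥)
open import Data.Sum using (_⊎_)
open import Relation.Nullary using (¬_)
open import Relation.Binary.PropositionalEquality using (_≡_; _≢_)

-- The real numbers, axiomatised as a complete ordered field.
-- (agda-stdlib has no reals; these axioms determine ℝ up to isomorphism.)

record RealField : Set₁ where
  infixl 6 _+_
  infixl 7 _*_
  infix  4 _<_
  field
    ℝ   : Set
    _+_ : ℝ → ℝ → ℝ
    _*_ : ℝ → ℝ → ℝ
    -_  : ℝ → ℝ
    0ℝ  : ℝ
    1ℝ  : ℝ
    _<_ : ℝ → ℝ → Set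
    +-assoc     : ∀ x y z → (x + y) + z ≡ x + (y + z)
    +-comm      : ∀ x y → x + y ≡ y + x
    +-identityˡ : ∀ x → 0ℝ + x ≡ x
    -‿inverseˡ  : ∀ x → (- x) + x ≡ 0ℝ
    *-assoc     : ∀ x y z → (x * y) * z ≡ x * (y * z)
    *-comm      : ∀ x y → x * y ≡ y * x
    *-identityˡ : ∀ x → 1ℝ * x ≡ x
    distribˡ    : ∀ x y z → x * (y + z) ≡ x * y + x * z
    0≢1         : 0ℝ ≢ 1ℝ
    inverse     : ∀ x → x ≢ 0ℝ → ∃ λ y → y * x ≡ 1ℝ
    <-irrefl    : ∀ x → ¬ (x < x)
    <-trans     : ∀ x y z → x < y → y < z → x < z
    <-trichotomy : ∀ x y → (x < y) ⊎ ((x ≡ y) ⊎ (y < x))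
    <-+         : ∀ x y z → x < y → x + z < y + z
    <-*         : ∀ x y → 0ℝ < x → 0ℝ < y → 0ℝ < x * y
    complete    : (S : ℝ → Set) → (∃ λ x → S x) →
                  (∃ λ b → ∀ x → S x → ¬ (b < x)) →
                  ∃ λ s → (∀ x → S x → ¬ (s < x)) ×
                          (∀ b → (∀ x → S x → ¬ (b < x)) → ¬ (b < s))

-- Digraphs on vertex set Fin n: arc u w ≡ true iff there is an arc u → w
-- (the value on the diagonal is irrelevant).

record Digraph (n : ℕ) : Set where
  constructor digraph
  field arc : Fin n → Fin n → Bool
open Digraph public

reverse : ∀ {n} → Digraph n → Digraph n
reverse D = digraph (λ u w → arc D w u)

K₃ : Digraph 3
K₃ = digraph (λ _ _ → true)

-- N₄ : a,b,c,d = 0,1,2,3; arcs ab,ba,bc,cb,cd,dc,ac,db.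
N₄arc : Fin 4 → Fin 4 → Bool
N₄arc zero (suc zero) = true
N₄arc (suc zero) zero = true
N₄arc (suc zero) (suc (suc zero)) = true
N₄arc (suc (suc zero)) (suc zero) = true
N₄arc (suc (suc zero)) (suc (suc (suc zero))) = true
N₄arc (suc (suc (suc zero))) (suc (suc zero)) = true
N₄arc zero (suc (suc zero)) = true
N₄arc (suc (suc (suc zero))) (suc zero) = true
N₄arc _ _ = false

N₄ : Digraph 4
N₄ = digraph N₄arc

-- M₅ : a,b,c,d,e = 0,1,2,3,4; arcs ab,ba,bc,cb,cd,dc,de,ed,ac,ec.
M₅arc : Fin 5 → Fin 5 → Bool
M₅arc zero (suc zero) = true
M₅arc (suc zero) zero = true
M₅arc (suc zero) (suc (suc zero)) = true
M₅arc (suc (suc zero)) (suc zero) = true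
M₅arc (suc (suc zero)) (suc (suc (suc zero))) = true
M₅arc (suc (suc (suc zero))) (suc (suc zero)) = true
M₅arc (suc (suc (suc zero))) (suc (suc (suc (suc zero)))) = true
M₅arc (suc (suc (suc (suc zero)))) (suc (suc (suc zero))) = true
M₅arc zero (suc (suc zero)) = true
M₅arc (suc (suc (suc (suc zero)))) (suc (suc zero)) = true
M₅arc _ _ = false

M₅ : Digraph 5
M₅ = digraph M₅arc

module Matrices (R : RealField) where
  open RealField R

  Mat : ℕ → Set
  Mat n = Fin n → Fin n → ℝ

  sumFin : ∀ n → (Fin n → ℝ) → ℝ
  sumFin zero    f = 0ℝ
  sumFin (suc n) f = f zero + sumFin n (λ i → f (suc i))

  InQ : ∀ {n} → Digraph n → Mat n → Set
  InQ {n} D B =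
    (∀ u → B u u ≢ 0ℝ) ×
    (∀ u w → u ≢ w → arc D u w ≡ true  → B u w ≢ 0ℝ) ×
    (∀ u w → u ≢ w → arc D u w ≡ false → B u w ≡ 0ℝ)

  ASAP : ∀ {n} → Mat n → Set
  ASAP {n} B = (X : Mat n) →
    (∀ u w → X u w * B u w ≡ 0ℝ) →
    (∀ i j → sumFin n (λ k → X k i * B k j) ≡ 0ℝ) →
    (∀ i j → sumFin n (λ k → B i k * X j k) ≡ 0ℝ) →
    ∀ i j → X i j ≡ 0ℝ

  NullityAtLeast : ∀ {n} → ℕ → Mat n → Set
  NullityAtLeast {n} k B = Σ (Fin k → Fin n → ℝ) λ v →
    (∀ i r → sumFin n (λ c → B r c * v i c) ≡ 0ℝ) ×
    (∀ (a : Fin k → ℝ) → (∀ c → sumFin k (λ i → a i * v i c) ≡ 0ℝ) → ∀ i → a i ≡ 0ℝ)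

  NullityEq : ∀ {n} → ℕ → Mat n → Set
  NullityEq k B = NullityAtLeast k B × ¬ NullityAtLeast (suc k) B

  νAtLeast : ∀ {n} → Digraph n → ℕ → Set
  νAtLeast D k = Σ _ λ B → InQ D B × ASAP B × NullityAtLeast k B

  νEq : ∀ {n} → Digraph n → ℕ → Set
  νEq D k =
    (Σ _ λ B → InQ D B × ASAP B × NullityEq k B) ×
    (∀ B → InQ D B → ASAP B → ¬ NullityAtLeast (suc k) B)

{-# OPTIONS --safe #-}
module Submission where

-- Each lower bound is witnessed by the pattern matrix of D: 1 on the diagonal and on arcs, 0
-- elsewhere. Its kernel contains two independent integer vectors, checked by computation in ℤ
-- and carried to ℝ by the ring map ℤ → ℝ. Its ASAP comes from zero forcing: X ∘ B = 0 kills X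
-- on the pattern, and an entry (BXᵀ)ᵢⱼ = Σₖ Bᵢₖ Xⱼₖ = 0 in which a single term is not yet known
-- to vanish kills the Xⱼₖ of that term; iterating reaches all of X. ASAP is invariant under
-- transposition, which handles the reversed digraphs.
-- The bound ν⃗(K₃) ≤ 2 is an instance of ν⃗(D) ≤ n - 1 on n vertices: B ∈ Q(D) has a nonzero
-- entry B r c, and if its kernel contained n independent vectors, eliminating coordinate c
-- (n vectors in ℝⁿ⁻¹ are dependent) would give a nontrivial combination of them vanishing off c,
-- and, through row r, at c as well.

open import Defs
open import Level using (0ℓ)
open import Data.Nat as ℕ using (ℕ; zero; suc)
import Data.Nat.Properties as ℕ
open import Data.Integer as ℤ using (ℤ; -[1+_]; _⊖_; sign; ∣_∣; _◃_; 0ℤ; 1ℤ; -1ℤ)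
import Data.Integer.Properties as ℤ
open import Algebra.Definitions.RawMonoid ℤ.+-0-rawMonoid using () renaming (sum to ∑ℤ)
open import Data.Sign as Sign using (Sign)
open import Data.Bool using (Bool; true; false; T; not; _∨_; if_then_else_)
open import Data.Bool.Properties using (T-∨)
open import Data.Fin using (Fin; zero; suc; punchIn; punchOut)
open import Data.Fin.Patterns using (0F; 1F; 2F; 3F)
open import Data.Fin.Properties using (punchIn-punchOut; punchInᵢ≢i)
import Data.Fin.Properties as Fin
open import Data.Vec using (Vec; []; _∷_; lookup)
open import Data.Vec.Functional using (insertAt)
open import Data.Vec.Functional.Properties using (insertAt-lookup; insertAt-punchIn)
open import Data.Product using (_×_; _,_; ∃-syntax; proj₁; proj₂)
open import Data.Sum using (_⊎_; inj₁; inj₂)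
open import Data.Maybe using (Maybe; just; nothing)
open import Function using (_∘_; Equivalence)
open import Relation.Nullary using (¬_; Dec; yes; no; ¬?; contradiction)
open import Relation.Nullary.Decidable
  using (⌊_⌋; _×-dec_; _⊎-dec_; _→-dec_; toWitness; T?; decidable-stable)
open import Relation.Binary.Definitions using (DecidableEquality)
open import Relation.Binary.PropositionalEquality
open ≡-Reasoning
open import Algebra.Bundles using (CommutativeRing)
open import Algebra.Consequences.Propositional
  using (comm∧idˡ⇒idʳ; comm∧invˡ⇒invʳ; comm∧distrˡ⇒distrʳ)
open import Algebra.Solver.Ring.AlmostCommutativeRing
  using (fromCommutativeRing; _-Raw-AlmostCommutative⟶_)
import Algebra.Properties.Ring as RingProperties
import Algebra.Properties.AbelianGroup as AbelianGroupProperties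
import Algebra.Properties.Semiring.Mult.TCOptimised as Multiples
import Algebra.Properties.Semiring.Sum as SemiringSum
import Algebra.Solver.Ring as RingSolver

module FieldProperties (R : RealField) where
  open RealField R

  commutativeRing : CommutativeRing 0ℓ 0ℓ
  commutativeRing = record
    { Carrier = ℝ ; _≈_ = _≡_ ; _+_ = _+_ ; _*_ = _*_ ; -_ = -_ ; 0# = 0ℝ ; 1# = 1ℝ
    ; isCommutativeRing = record
      { isRing = record
        { +-isAbelianGroup = record
          { isGroup = record
            { isMonoid = record
              { isSemigroup = record
                { isMagma = record { isEquivalence = isEquivalence ; ∙-cong = cong₂ _+_ }
                ; assoc = +-assoc }
              ; identity = +-identityˡ , comm∧idˡ⇒idʳ +-comm +-identityˡ }
            ; inverse = -‿inverseˡ , comm∧invˡ⇒invʳ +-comm -‿inverseˡ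
            ; ⁻¹-cong = cong -_ }
          ; comm = +-comm }
        ; *-cong = cong₂ _*_
        ; *-assoc = *-assoc
        ; *-identity = *-identityˡ , comm∧idˡ⇒idʳ *-comm *-identityˡ
        ; distrib = distribˡ , comm∧distrˡ⇒distrʳ *-comm distribˡ }
      ; *-comm = *-comm } }

  open CommutativeRing commutativeRing public
    using (+-identityʳ; *-identityʳ; -‿inverseʳ; zeroˡ; zeroʳ; semiring)
  open CommutativeRing commutativeRing using (ring; +-abelianGroup)
  open RingProperties ring using (-‿distribˡ-*; -‿distribʳ-*)
  open AbelianGroupProperties +-abelianGroup using (⁻¹-involutive; ε⁻¹≈ε; ⁻¹-∙-comm)
  open Multiples semiring using (1+×; ×-homo-+; ×1-homo-*) renaming (_×_ to _×′_)

  1≢0 : 1ℝ ≢ 0ℝ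
  1≢0 1≡0 = 0≢1 (sym 1≡0)

  infix 4 _≟_
  _≟_ : DecidableEquality ℝ
  x ≟ y with <-trichotomy x y
  ... | inj₁ x<y        = no λ x≡y → <-irrefl y (subst (_< y) x≡y x<y)
  ... | inj₂ (inj₁ x≡y) = yes x≡y
  ... | inj₂ (inj₂ y<x) = no λ x≡y → <-irrefl y (subst (y <_) x≡y y<x)

  x≡0⇒x*y≡0 : ∀ {x} y → x ≡ 0ℝ → x * y ≡ 0ℝ
  x≡0⇒x*y≡0 y refl = zeroˡ y

  y≡0⇒x*y≡0 : ∀ x {y} → y ≡ 0ℝ → x * y ≡ 0ℝ
  y≡0⇒x*y≡0 x refl = zeroʳ x

  x*y≡0⇒y≡0 : ∀ {x y} → x ≢ 0ℝ → x * y ≡ 0ℝ → y ≡ 0ℝ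
  x*y≡0⇒y≡0 {x} {y} x≢0 xy≡0 with inverse x x≢0
  ... | x⁻¹ , x⁻¹x≡1 = begin
    y                ≡⟨ *-identityˡ y ⟨
    1ℝ * y           ≡⟨ cong (_* y) x⁻¹x≡1 ⟨
    (x⁻¹ * x) * y    ≡⟨ *-assoc x⁻¹ x y ⟩
    x⁻¹ * (x * y)    ≡⟨ y≡0⇒x*y≡0 x⁻¹ xy≡0 ⟩
    0ℝ               ∎

  x+-[x+y]≡-y : ∀ x y → x + - (x + y) ≡ - y
  x+-[x+y]≡-y x y = begin
    x + - (x + y)      ≡⟨ cong (x +_) (⁻¹-∙-comm x y) ⟨
    x + (- x + - y)    ≡⟨ +-assoc x (- x) (- y) ⟨
    (x + - x) + - y    ≡⟨ cong (_+ - y) (-‿inverseʳ x) ⟩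
    0ℝ + - y           ≡⟨ +-identityˡ (- y) ⟩
    - y                ∎

  fromℕ : ℕ → ℝ
  fromℕ n = n ×′ 1ℝ

  fromℕ-suc : ∀ n → fromℕ (suc n) ≡ 1ℝ + fromℕ n
  fromℕ-suc n = 1+× n 1ℝ

  fromℤ : ℤ → ℝ
  fromℤ (ℤ.+ n)  = fromℕ n
  fromℤ -[1+ n ] = - fromℕ (suc n)

  fromℤ-homo‿- : ∀ i → fromℤ (ℤ.- i) ≡ - fromℤ i
  fromℤ-homo‿- (ℤ.+ zero)  = sym ε⁻¹≈ε
  fromℤ-homo‿- (ℤ.+ suc n) = refl
  fromℤ-homo‿- -[1+ n ]    = sym (⁻¹-involutive _)

  fromℤ-⊖ : ∀ m n → fromℤ (m ⊖ n) ≡ fromℕ m + - fromℕ n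
  fromℤ-⊖ m       zero    = begin
    fromℤ (m ⊖ 0)      ≡⟨ cong fromℤ (ℤ.⊖-≥ {m} ℕ.z≤n) ⟩
    fromℕ m            ≡⟨ +-identityʳ (fromℕ m) ⟨
    fromℕ m + 0ℝ       ≡⟨ cong (fromℕ m +_) ε⁻¹≈ε ⟨
    fromℕ m + - 0ℝ     ∎
  fromℤ-⊖ zero    (suc n) = sym (+-identityˡ _)
  fromℤ-⊖ (suc m) (suc n) = begin
    fromℤ (suc m ⊖ suc n)              ≡⟨ cong fromℤ (ℤ.[1+m]⊖[1+n]≡m⊖n m n) ⟩
    fromℤ (m ⊖ n)                      ≡⟨ fromℤ-⊖ m n ⟩
    fromℕ m + - fromℕ n                ≡⟨ cong (fromℕ m +_) (x+-[x+y]≡-y 1ℝ (fromℕ n)) ⟨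
    fromℕ m + (1ℝ + - (1ℝ + fromℕ n))  ≡⟨ +-assoc (fromℕ m) 1ℝ _ ⟨
    (fromℕ m + 1ℝ) + - (1ℝ + fromℕ n)  ≡⟨ cong₂ (λ a b → a + - b) (+-comm 1ℝ (fromℕ m)) (fromℕ-suc n) ⟨
    (1ℝ + fromℕ m) + - fromℕ (suc n)   ≡⟨ cong (λ a → a + - fromℕ (suc n)) (fromℕ-suc m) ⟨
    fromℕ (suc m) + - fromℕ (suc n)    ∎

  fromℤ-homo-+ : ∀ i j → fromℤ (i ℤ.+ j) ≡ fromℤ i + fromℤ j
  fromℤ-homo-+ (ℤ.+ m)  (ℤ.+ n)  = ×-homo-+ 1ℝ m n
  fromℤ-homo-+ (ℤ.+ m)  -[1+ n ] = fromℤ-⊖ m (suc n)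
  fromℤ-homo-+ -[1+ m ] (ℤ.+ n)  = trans (fromℤ-⊖ n (suc m)) (+-comm _ _)
  fromℤ-homo-+ -[1+ m ] -[1+ n ] = begin
    - fromℕ (suc (suc (m ℕ.+ n)))       ≡⟨ cong (λ k → - fromℕ (suc k)) (ℕ.+-suc m n) ⟨
    - fromℕ (suc m ℕ.+ suc n)           ≡⟨ cong -_ (×-homo-+ 1ℝ (suc m) (suc n)) ⟩
    - (fromℕ (suc m) + fromℕ (suc n))   ≡⟨ ⁻¹-∙-comm _ _ ⟨
    - fromℕ (suc m) + - fromℕ (suc n)   ∎

  signed : Sign → ℝ → ℝ
  signed Sign.+ x = x
  signed Sign.- x = - x

  signed-* : ∀ s t x y → signed (s Sign.* t) (x * y) ≡ signed s x * signed t y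
  signed-* Sign.+ Sign.+ x y = refl
  signed-* Sign.+ Sign.- x y = -‿distribʳ-* x y
  signed-* Sign.- Sign.+ x y = -‿distribˡ-* x y
  signed-* Sign.- Sign.- x y = begin
    x * y          ≡⟨ ⁻¹-involutive (x * y) ⟨
    - - (x * y)    ≡⟨ cong -_ (-‿distribˡ-* x y) ⟩
    - (- x * y)    ≡⟨ -‿distribʳ-* (- x) y ⟩
    - x * - y      ∎

  fromℤ-◃ : ∀ s n → fromℤ (s ◃ n) ≡ signed s (fromℕ n)
  fromℤ-◃ Sign.+ n = cong fromℤ (ℤ.+◃n≡+n n)
  fromℤ-◃ Sign.- n = trans (cong fromℤ (ℤ.-◃n≡-n n)) (fromℤ-homo‿- (ℤ.+ n))

  fromℤ-signAbs : ∀ i → fromℤ i ≡ signed (sign i) (fromℕ ∣ i ∣)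
  fromℤ-signAbs (ℤ.+ n)  = refl
  fromℤ-signAbs -[1+ n ] = refl

  fromℤ-homo-* : ∀ i j → fromℤ (i ℤ.* j) ≡ fromℤ i * fromℤ j
  fromℤ-homo-* i j = begin
    fromℤ (s ◃ ∣ i ∣ ℕ.* ∣ j ∣)
      ≡⟨ fromℤ-◃ s (∣ i ∣ ℕ.* ∣ j ∣) ⟩
    signed s (fromℕ (∣ i ∣ ℕ.* ∣ j ∣))
      ≡⟨ cong (signed s) (×1-homo-* ∣ i ∣ ∣ j ∣) ⟩
    signed s (fromℕ ∣ i ∣ * fromℕ ∣ j ∣)
      ≡⟨ signed-* (sign i) (sign j) _ _ ⟩
    signed (sign i) (fromℕ ∣ i ∣) * signed (sign j) (fromℕ ∣ j ∣)
      ≡⟨ cong₂ _*_ (fromℤ-signAbs i) (fromℤ-signAbs j) ⟨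
    fromℤ i * fromℤ j
      ∎
    where s = sign i Sign.* sign j

  fromℤ-morphism : ℤ.+-*-rawRing -Raw-AlmostCommutative⟶ fromCommutativeRing commutativeRing
  fromℤ-morphism = record
    { ⟦_⟧ = fromℤ ; +-homo = fromℤ-homo-+ ; *-homo = fromℤ-homo-* ; -‿homo = fromℤ-homo‿-
    ; 0-homo = refl ; 1-homo = refl }

  fromℤ-≟ : ∀ i j → Maybe (fromℤ i ≡ fromℤ j)
  fromℤ-≟ i j with i ℤ.≟ j
  ... | yes i≡j = just (cong fromℤ i≡j)
  ... | no  _   = nothing

  -- Normal forms are compared by computation, so the solver needs coefficients whose arithmetic
  -- reduces: ℤ, mapped into ℝ, rather than ℝ itself.
  open RingSolver ℤ.+-*-rawRing (fromCommutativeRing commutativeRing) fromℤ-morphism fromℤ-≟ public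
    using (solve; _:+_; _:*_; :-_; _:-_; _:=_)

IsKernelBasis : ∀ {k n} (A : Fin n → Fin n → ℤ) (v : Fin k → Fin n → ℤ) (p : Fin k → Fin n) → Set
IsKernelBasis A v p =
  (∀ i r → ∑ℤ (λ c → A r c ℤ.* v i c) ≡ 0ℤ) ×
  (∀ i → v i (p i) ≡ 1ℤ) ×
  (∀ i j → i ≢ j → v i (p j) ≡ 0ℤ)

isKernelBasis? : ∀ {k n} (A : Fin n → Fin n → ℤ) (v : Fin k → Fin n → ℤ) (p : Fin k → Fin n) →
                 Dec (IsKernelBasis A v p)
isKernelBasis? A v p =
  Fin.all? (λ i → Fin.all? λ r → ∑ℤ (λ c → A r c ℤ.* v i c) ℤ.≟ 0ℤ) ×-dec
  Fin.all? (λ i → v i (p i) ℤ.≟ 1ℤ) ×-dec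
  Fin.all? (λ i → Fin.all? λ j → ¬? (i Fin.≟ j) →-dec (v i (p j) ℤ.≟ 0ℤ))

module LinearAlgebra (R : RealField) where
  open RealField R
  open Matrices R
  open FieldProperties R
  open SemiringSum semiring
    using ( sum; sum-cong-≗; sum-replicate-zero; sum-remove
          ; ∑-distrib-+; ∑-comm; *-distribˡ-sum; *-distribʳ-sum)

  sumFin≡sum : ∀ n (f : Fin n → ℝ) → sumFin n f ≡ sum f
  sumFin≡sum zero    f = refl
  sumFin≡sum (suc n) f = cong (f zero +_) (sumFin≡sum n (f ∘ suc))

  module _ {n : ℕ} where

    sumFin-cong : ∀ {f g : Fin n → ℝ} → (∀ i → f i ≡ g i) → sumFin n f ≡ sumFin n g
    sumFin-cong {f} {g} f≗g = begin
      sumFin n f   ≡⟨ sumFin≡sum n f ⟩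
      sum f        ≡⟨ sum-cong-≗ f≗g ⟩
      sum g        ≡⟨ sumFin≡sum n g ⟨
      sumFin n g   ∎

    sumFin-zero : ∀ {f : Fin n → ℝ} → (∀ i → f i ≡ 0ℝ) → sumFin n f ≡ 0ℝ
    sumFin-zero {f} f≗0 = begin
      sumFin n f           ≡⟨ sumFin≡sum n f ⟩
      sum f                ≡⟨ sum-cong-≗ f≗0 ⟩
      sum {n} (λ _ → 0ℝ)   ≡⟨ sum-replicate-zero n ⟩
      0ℝ                   ∎

    sumFin-+ : ∀ (f g : Fin n → ℝ) → sumFin n (λ i → f i + g i) ≡ sumFin n f + sumFin n g
    sumFin-+ f g = begin
      sumFin n (λ i → f i + g i)   ≡⟨ sumFin≡sum n _ ⟩
      sum (λ i → f i + g i)        ≡⟨ ∑-distrib-+ f g ⟩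
      sum f + sum g                ≡⟨ cong₂ _+_ (sumFin≡sum n f) (sumFin≡sum n g) ⟨
      sumFin n f + sumFin n g      ∎

    sumFin-*ˡ : ∀ x (f : Fin n → ℝ) → sumFin n (λ i → x * f i) ≡ x * sumFin n f
    sumFin-*ˡ x f = begin
      sumFin n (λ i → x * f i)   ≡⟨ sumFin≡sum n _ ⟩
      sum (λ i → x * f i)        ≡⟨ *-distribˡ-sum x f ⟨
      x * sum f                  ≡⟨ cong (x *_) (sumFin≡sum n f) ⟨
      x * sumFin n f             ∎

    sumFin-*ʳ : ∀ x (f : Fin n → ℝ) → sumFin n (λ i → f i * x) ≡ sumFin n f * x
    sumFin-*ʳ x f = begin
      sumFin n (λ i → f i * x)   ≡⟨ sumFin≡sum n _ ⟩
      sum (λ i → f i * x)        ≡⟨ *-distribʳ-sum x f ⟨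
      sum f * x                  ≡⟨ cong (_* x) (sumFin≡sum n f) ⟨
      sumFin n f * x             ∎

    sumFin-remove : ∀ (f : Fin (suc n) → ℝ) p → sumFin (suc n) f ≡ f p + sumFin n (f ∘ punchIn p)
    sumFin-remove f p = begin
      sumFin (suc n) f                 ≡⟨ sumFin≡sum (suc n) f ⟩
      sum f                            ≡⟨ sum-remove f ⟩
      f p + sum (f ∘ punchIn p)        ≡⟨ cong (f p +_) (sumFin≡sum n (f ∘ punchIn p)) ⟨
      f p + sumFin n (f ∘ punchIn p)   ∎

    sumFin-concentrated : ∀ (f : Fin (suc n) → ℝ) p → (∀ j → f (punchIn p j) ≡ 0ℝ) →
                          sumFin (suc n) f ≡ f p
    sumFin-concentrated f p f≡0-off-p = begin
      sumFin (suc n) f                 ≡⟨ sumFin-remove f p ⟩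
      f p + sumFin n (f ∘ punchIn p)   ≡⟨ cong (f p +_) (sumFin-zero f≡0-off-p) ⟩
      f p + 0ℝ                         ≡⟨ +-identityʳ (f p) ⟩
      f p                              ∎

  sumFin-comm : ∀ {m n} (f : Fin m → Fin n → ℝ) →
                sumFin m (λ i → sumFin n (f i)) ≡ sumFin n (λ j → sumFin m (λ i → f i j))
  sumFin-comm {m} {n} f = begin
    sumFin m (λ i → sumFin n (f i))           ≡⟨ sumFin-cong (λ i → sumFin≡sum n (f i)) ⟩
    sumFin m (λ i → sum (f i))                ≡⟨ sumFin≡sum m _ ⟩
    sum (λ i → sum (f i))                     ≡⟨ ∑-comm f ⟩
    sum (λ j → sum (λ i → f i j))             ≡⟨ sumFin≡sum n _ ⟨
    sumFin n (λ j → sum (λ i → f i j))        ≡⟨ sumFin-cong (λ j → sumFin≡sum m (λ i → f i j)) ⟨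
    sumFin n (λ j → sumFin m (λ i → f i j))   ∎

  lincomb : ∀ {k n} → (Fin k → ℝ) → (Fin k → Fin n → ℝ) → Fin n → ℝ
  lincomb {k} a v c = sumFin k (λ i → a i * v i c)

  LinearlyIndependent : ∀ {k n} → (Fin k → Fin n → ℝ) → Set
  LinearlyIndependent v = ∀ a → (∀ c → lincomb a v c ≡ 0ℝ) → ∀ i → a i ≡ 0ℝ

  LinearlyDependent : ∀ {k n} → (Fin k → Fin n → ℝ) → Set
  LinearlyDependent v = ∃[ a ] (∃[ i ] a i ≢ 0ℝ) × (∀ c → lincomb a v c ≡ 0ℝ)

  sumFin-lincomb : ∀ {k n} (x : Fin n → ℝ) a (v : Fin k → Fin n → ℝ) →
    sumFin n (λ c → x c * lincomb a v c) ≡ sumFin k (λ i → a i * sumFin n (λ c → x c * v i c))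
  sumFin-lincomb {k} {n} x a v = begin
    sumFin n (λ c → x c * lincomb a v c)
      ≡⟨ sumFin-cong (λ c → sumFin-*ˡ (x c) (λ i → a i * v i c)) ⟨
    sumFin n (λ c → sumFin k (λ i → x c * (a i * v i c)))
      ≡⟨ sumFin-cong (λ c → sumFin-cong (λ i → swap (x c) (a i) (v i c))) ⟩
    sumFin n (λ c → sumFin k (λ i → a i * (x c * v i c)))
      ≡⟨ sumFin-comm (λ i c → a i * (x c * v i c)) ⟨
    sumFin k (λ i → sumFin n (λ c → a i * (x c * v i c)))
      ≡⟨ sumFin-cong (λ i → sumFin-*ˡ (a i) (λ c → x c * v i c)) ⟩
    sumFin k (λ i → a i * sumFin n (λ c → x c * v i c))
      ∎
    where
    swap : ∀ x a v → x * (a * v) ≡ a * (x * v)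
    swap = solve 3 (λ x a v → x :* (a :* v) := a :* (x :* v)) refl

  vanishing-first-coordinate⇒dependent : ∀ {m n} (w : Fin (suc m) → Fin (suc n) → ℝ) →
    (∀ i → w i zero ≡ 0ℝ) → LinearlyDependent (λ i c → w (suc i) (suc c)) → LinearlyDependent w
  vanishing-first-coordinate⇒dependent w w₀≡0 (b , (i , bᵢ≢0) , rel) = a , (suc i , bᵢ≢0) , rel′
    where
    a : Fin _ → ℝ
    a = insertAt b zero 0ℝ

    rel′ : ∀ c → lincomb a w c ≡ 0ℝ
    rel′ zero    = trans (cong₂ _+_ (zeroˡ _) (sumFin-zero λ i → y≡0⇒x*y≡0 (b i) (w₀≡0 (suc i))))
                         (+-identityˡ 0ℝ)
    rel′ (suc c) = trans (cong₂ _+_ (zeroˡ _) (rel c)) (+-identityˡ 0ℝ)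

  module GaussStep {m n} (w : Fin (suc m) → Fin (suc n) → ℝ) (p : Fin (suc m))
                   (s : ℝ) (s*pivot≡1 : s * w p zero ≡ 1ℝ) where

    μ : Fin m → ℝ
    μ i = w (punchIn p i) zero * s

    residual : Fin m → Fin (suc n) → ℝ
    residual i c = w (punchIn p i) c + - (μ i * w p c)

    residual-zero : ∀ i → residual i zero ≡ 0ℝ
    residual-zero i = begin
      x + - ((x * s) * π)   ≡⟨ cong (λ t → x + - t) (*-assoc x s π) ⟩
      x + - (x * (s * π))   ≡⟨ cong (λ t → x + - (x * t)) s*pivot≡1 ⟩
      x + - (x * 1ℝ)        ≡⟨ cong (λ t → x + - t) (*-identityʳ x) ⟩
      x + - x               ≡⟨ -‿inverseʳ x ⟩
      0ℝ                    ∎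
      where x = w (punchIn p i) zero ; π = w p zero

    lincomb-residual : ∀ b c → lincomb b (w ∘ punchIn p) c
                               ≡ lincomb b residual c + sumFin m (λ i → b i * μ i) * w p c
    lincomb-residual b c = begin
      sumFin m (λ i → b i * w (punchIn p i) c)
        ≡⟨ sumFin-cong (λ i → split (b i) (w (punchIn p i) c) (μ i) (w p c)) ⟩
      sumFin m (λ i → b i * residual i c + (b i * μ i) * w p c)
        ≡⟨ sumFin-+ (λ i → b i * residual i c) (λ i → (b i * μ i) * w p c) ⟩
      lincomb b residual c + sumFin m (λ i → (b i * μ i) * w p c)
        ≡⟨ cong (lincomb b residual c +_) (sumFin-*ʳ (w p c) (λ i → b i * μ i)) ⟩
      lincomb b residual c + sumFin m (λ i → b i * μ i) * w p c
        ∎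
      where
      split : ∀ b x μ y → b * x ≡ b * (x + - (μ * y)) + (b * μ) * y
      split = solve 4 (λ b x μ y → b :* x := b :* (x :- μ :* y) :+ (b :* μ) :* y) refl

    residual-dependent⇒dependent : LinearlyDependent (λ i c → residual i (suc c)) → LinearlyDependent w
    residual-dependent⇒dependent (b , (i , bᵢ≢0) , rel) =
      a , (punchIn p i , bᵢ≢0 ∘ trans (sym aᵢ≡bᵢ)) , rel′
      where
      σ : ℝ
      σ = sumFin m (λ i → b i * μ i)

      a : Fin (suc m) → ℝ
      a = insertAt b p (- σ)

      aᵢ≡bᵢ : a (punchIn p i) ≡ b i
      aᵢ≡bᵢ = insertAt-punchIn b p (- σ) i

      residual-rel : ∀ c → lincomb b residual c ≡ 0ℝ
      residual-rel zero    = sumFin-zero (λ i → y≡0⇒x*y≡0 (b i) (residual-zero i))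
      residual-rel (suc c) = rel c

      rel′ : ∀ c → lincomb a w c ≡ 0ℝ
      rel′ c = begin
        lincomb a w c
          ≡⟨ sumFin-remove (λ j → a j * w j c) p ⟩
        a p * w p c + sumFin m (λ i → a (punchIn p i) * w (punchIn p i) c)
          ≡⟨ cong₂ (λ x y → x * w p c + y) (insertAt-lookup b p (- σ))
                   (sumFin-cong λ i → cong (_* w (punchIn p i) c) (insertAt-punchIn b p (- σ) i)) ⟩
        - σ * w p c + lincomb b (w ∘ punchIn p) c
          ≡⟨ cong (- σ * w p c +_) (lincomb-residual b c) ⟩
        - σ * w p c + (lincomb b residual c + σ * w p c)
          ≡⟨ cancel σ (w p c) (lincomb b residual c) ⟩
        lincomb b residual c
          ≡⟨ residual-rel c ⟩
        0ℝ
          ∎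
        where
        cancel : ∀ σ x y → - σ * x + (y + σ * x) ≡ y
        cancel = solve 3 (λ σ x y → :- σ :* x :+ (y :+ σ :* x) := y) refl

  1+n-vectors-dependent : ∀ {n} (w : Fin (suc n) → Fin n → ℝ) → LinearlyDependent w
  1+n-vectors-dependent {zero}  w = (λ _ → 1ℝ) , (zero , 1≢0) , λ ()
  1+n-vectors-dependent {suc n} w with Fin.any? (λ i → ¬? (w i zero ≟ 0ℝ))
  ... | yes (p , pivot≢0) with inverse (w p zero) pivot≢0
  ...   | s , s*pivot≡1 =
    residual-dependent⇒dependent (1+n-vectors-dependent (λ i c → residual i (suc c)))
    where open GaussStep w p s s*pivot≡1
  1+n-vectors-dependent {suc n} w | no ∄pivot =
    vanishing-first-coordinate⇒dependent w
      (λ i → decidable-stable (w i zero ≟ 0ℝ) (λ wᵢ≢0 → ∄pivot (i , wᵢ≢0)))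
      (1+n-vectors-dependent (λ i c → w (suc i) (suc c)))

  entry≢0⇒nullity<n : ∀ {n} (B : Mat (suc n)) r c → B r c ≢ 0ℝ → ¬ NullityAtLeast (suc n) B
  entry≢0⇒nullity<n {n} B r c Brc≢0 (v , Bv≡0 , independent)
    with 1+n-vectors-dependent (λ i j → v i (punchIn c j))
  ... | a , (i , aᵢ≢0) , u≡0-off-c = aᵢ≢0 (independent a u≡0 i)
    where
    u : Fin (suc n) → ℝ
    u = lincomb a v

    Bu≡0 : B r c * u c ≡ 0ℝ
    Bu≡0 = begin
      B r c * u c
        ≡⟨ sumFin-concentrated (λ k → B r k * u k) c (λ j → y≡0⇒x*y≡0 (B r (punchIn c j)) (u≡0-off-c j)) ⟨
      sumFin (suc n) (λ k → B r k * u k)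
        ≡⟨ sumFin-lincomb (B r) a v ⟩
      sumFin (suc n) (λ i → a i * sumFin (suc n) (λ k → B r k * v i k))
        ≡⟨ sumFin-zero (λ i → y≡0⇒x*y≡0 (a i) (Bv≡0 i r)) ⟩
      0ℝ
        ∎

    u≡0 : ∀ k → u k ≡ 0ℝ
    u≡0 k with c Fin.≟ k
    ... | yes refl = x*y≡0⇒y≡0 Brc≢0 Bu≡0
    ... | no  c≢k  = trans (cong u (sym (punchIn-punchOut c≢k))) (u≡0-off-c (punchOut c≢k))

  pivots⇒independent : ∀ {k n} (v : Fin k → Fin n → ℝ) (p : Fin k → Fin n) →
    (∀ i → v i (p i) ≢ 0ℝ) → (∀ i j → i ≢ j → v i (p j) ≡ 0ℝ) → LinearlyIndependent v
  pivots⇒independent {zero}  v p pivot≢0 off-pivot≡0 a rel ()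
  pivots⇒independent {suc k} v p pivot≢0 off-pivot≡0 a rel j =
    x*y≡0⇒y≡0 (pivot≢0 j) (trans (*-comm (v j (p j)) (a j)) aⱼvⱼ≡0)
    where
    aⱼvⱼ≡0 : a j * v j (p j) ≡ 0ℝ
    aⱼvⱼ≡0 = begin
      a j * v j (p j)
        ≡⟨ sumFin-concentrated (λ i → a i * v i (p j)) j
             (λ l → y≡0⇒x*y≡0 (a (punchIn j l)) (off-pivot≡0 _ j (punchInᵢ≢i j l))) ⟨
      lincomb a v (p j)
        ≡⟨ rel (p j) ⟩
      0ℝ
        ∎

  fromℤ-∑ : ∀ {n} (f : Fin n → ℤ) → fromℤ (∑ℤ f) ≡ sumFin n (fromℤ ∘ f)
  fromℤ-∑ {zero}  f = refl
  fromℤ-∑ {suc n} f =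
    trans (fromℤ-homo-+ (f zero) (∑ℤ (f ∘ suc))) (cong (fromℤ (f zero) +_) (fromℤ-∑ (f ∘ suc)))

  kernelBasis⇒nullity : ∀ {k n} {A : Fin n → Fin n → ℤ} {v p} → IsKernelBasis A v p →
                        NullityAtLeast k (λ r c → fromℤ (A r c))
  kernelBasis⇒nullity {k} {n} {A} {v} {p} (Av≡0 , pivot≡1 , off-pivot≡0) =
    (λ i c → fromℤ (v i c)) , Av≡0ℝ , pivots⇒independent _ p pivot≢0 (λ i j → cong fromℤ ∘ off-pivot≡0 i j)
    where
    Av≡0ℝ : ∀ i r → sumFin n (λ c → fromℤ (A r c) * fromℤ (v i c)) ≡ 0ℝ
    Av≡0ℝ i r = begin
      sumFin n (λ c → fromℤ (A r c) * fromℤ (v i c))   ≡⟨ sumFin-cong (λ c → fromℤ-homo-* (A r c) (v i c)) ⟨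
      sumFin n (λ c → fromℤ (A r c ℤ.* v i c))         ≡⟨ fromℤ-∑ (λ c → A r c ℤ.* v i c) ⟨
      fromℤ (∑ℤ (λ c → A r c ℤ.* v i c))               ≡⟨ cong fromℤ (Av≡0 i r) ⟩
      0ℝ                                               ∎

    pivot≢0 : ∀ i → fromℤ (v i (p i)) ≢ 0ℝ
    pivot≢0 i = 1≢0 ∘ trans (cong fromℤ (sym (pivot≡1 i)))

module _ {n : ℕ} where

  Forces : (S K : Fin (suc n) → Fin (suc n) → Bool) (i j k : Fin (suc n)) → Set
  Forces S K i j k = T (S i k) × (∀ l → T (not (S i (punchIn k l))) ⊎ T (K j (punchIn k l)))

  forces? : ∀ S K i j k → Dec (Forces S K i j k)
  forces? S K i j k =
    T? (S i k) ×-dec Fin.all? (λ l → T? (not (S i (punchIn k l))) ⊎-dec T? (K j (punchIn k l)))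

  propagate : (S K : Fin (suc n) → Fin (suc n) → Bool) → Fin (suc n) → Fin (suc n) → Bool
  propagate S K j k = K j k ∨ ⌊ Fin.any? (λ i → forces? S K i j k) ⌋

  forcedZeros : ℕ → (S : Fin (suc n) → Fin (suc n) → Bool) → Fin (suc n) → Fin (suc n) → Bool
  forcedZeros zero    S = S
  forcedZeros (suc t) S = propagate S (forcedZeros t S)

module ArnoldProperty (R : RealField) where
  open RealField R
  open Matrices R
  open FieldProperties R
  open LinearAlgebra R

  HasSupport : ∀ {n} → Mat n → (Fin n → Fin n → Bool) → Set
  HasSupport B S = ∀ u w → (T (S u w) → B u w ≢ 0ℝ) × (T (not (S u w)) → B u w ≡ 0ℝ)

  module Forcing {n} {B : Mat (suc n)} {S} (support : HasSupport B S) (X : Mat (suc n))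
    (X∘B≡0 : ∀ u w → X u w * B u w ≡ 0ℝ)
    (BXᵀ≡0 : ∀ i j → sumFin (suc n) (λ k → B i k * X j k) ≡ 0ℝ) where

    Sound : (Fin (suc n) → Fin (suc n) → Bool) → Set
    Sound K = ∀ j k → T (K j k) → X j k ≡ 0ℝ

    support-sound : Sound S
    support-sound j k Sjk = x*y≡0⇒y≡0 (proj₁ (support j k) Sjk) (trans (*-comm (B j k) (X j k)) (X∘B≡0 j k))

    forces-sound : ∀ {K} → Sound K → ∀ {i j k} → Forces S K i j k → X j k ≡ 0ℝ
    forces-sound K-sound {i} {j} {k} (Sik , others) = x*y≡0⇒y≡0 (proj₁ (support i k) Sik) (begin
      B i k * X j k                             ≡⟨ sumFin-concentrated (λ k′ → B i k′ * X j k′) k term≡0 ⟨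
      sumFin (suc n) (λ k′ → B i k′ * X j k′)   ≡⟨ BXᵀ≡0 i j ⟩
      0ℝ                                        ∎)
      where
      term≡0 : ∀ l → B i (punchIn k l) * X j (punchIn k l) ≡ 0ℝ
      term≡0 l with others l
      ... | inj₁ ¬Sil = x≡0⇒x*y≡0 (X j (punchIn k l)) (proj₂ (support i (punchIn k l)) ¬Sil)
      ... | inj₂ Kjl  = y≡0⇒x*y≡0 (B i (punchIn k l)) (K-sound j (punchIn k l) Kjl)

    propagate-sound : ∀ {K} → Sound K → Sound (propagate S K)
    propagate-sound K-sound j k known with Equivalence.to T-∨ known
    ... | inj₁ Kjk    = K-sound j k Kjk
    ... | inj₂ forced with toWitness forced
    ...   | i , i-forces = forces-sound K-sound i-forces

    forcedZeros-sound : ∀ t → Sound (forcedZeros t S)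
    forcedZeros-sound zero    = support-sound
    forcedZeros-sound (suc t) = propagate-sound (forcedZeros-sound t)

  forcing⇒ASAP : ∀ {n} {B : Mat (suc n)} {S} → HasSupport B S →
                 ∀ t → (∀ u w → T (forcedZeros t S u w)) → ASAP B
  forcing⇒ASAP support t allForced X X∘B≡0 _ BXᵀ≡0 u w = forcedZeros-sound t u w (allForced u w)
    where open Forcing support X X∘B≡0 BXᵀ≡0

  ASAP-transpose : ∀ {n} {B C : Mat n} → (∀ u w → C u w ≡ B w u) → ASAP B → ASAP C
  ASAP-transpose {n} {B} {C} C≡Bᵀ B-ASAP X X∘C≡0 XᵀC≡0 CXᵀ≡0 i j = B-ASAP Xᵀ Xᵀ∘B≡0 XB≡0 BX≡0 j i
    where
    Xᵀ : Mat n
    Xᵀ u w = X w u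

    Xᵀ∘B≡0 : ∀ u w → Xᵀ u w * B u w ≡ 0ℝ
    Xᵀ∘B≡0 u w = trans (cong (X w u *_) (sym (C≡Bᵀ w u))) (X∘C≡0 w u)

    XB≡0 : ∀ i j → sumFin n (λ k → Xᵀ k i * B k j) ≡ 0ℝ
    XB≡0 i j = trans (sumFin-cong λ k → trans (*-comm (X i k) (B k j)) (cong (_* X i k) (sym (C≡Bᵀ j k))))
                     (CXᵀ≡0 j i)

    BX≡0 : ∀ i j → sumFin n (λ k → B i k * Xᵀ j k) ≡ 0ℝ
    BX≡0 i j = trans (sumFin-cong λ k → trans (*-comm (B i k) (X k j)) (cong (X k j *_) (sym (C≡Bᵀ k i))))
                     (XᵀC≡0 j i)

support : ∀ {n} → Digraph n → Fin n → Fin n → Bool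
support D u w = ⌊ u Fin.≟ w ⌋ ∨ arc D u w

patternℤ : ∀ {n} → Digraph n → Fin n → Fin n → ℤ
patternℤ D u w = if support D u w then 1ℤ else 0ℤ

module PatternMatrices (R : RealField) where
  open RealField R
  open Matrices R
  open FieldProperties R
  open LinearAlgebra R
  open ArnoldProperty R

  patternMatrix : ∀ {n} → Digraph n → Mat n
  patternMatrix D u w = fromℤ (patternℤ D u w)

  patternMatrix∈Q : ∀ {n} (D : Digraph n) → InQ D (patternMatrix D)
  patternMatrix∈Q D = diagonal≢0 , arc⇒≢0 , ¬arc⇒≡0
    where
    diagonal≢0 : ∀ u → patternMatrix D u u ≢ 0ℝ
    diagonal≢0 u with u Fin.≟ u
    ... | yes _   = 1≢0
    ... | no  u≢u = contradiction refl u≢u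

    arc⇒≢0 : ∀ u w → u ≢ w → arc D u w ≡ true → patternMatrix D u w ≢ 0ℝ
    arc⇒≢0 u w u≢w uw with u Fin.≟ w
    ... | yes u≡w = contradiction u≡w u≢w
    ... | no  _ rewrite uw = 1≢0

    ¬arc⇒≡0 : ∀ u w → u ≢ w → arc D u w ≡ false → patternMatrix D u w ≡ 0ℝ
    ¬arc⇒≡0 u w u≢w ¬uw with u Fin.≟ w
    ... | yes u≡w = contradiction u≡w u≢w
    ... | no  _ rewrite ¬uw = refl

  patternMatrix-support : ∀ {n} (D : Digraph n) → HasSupport (patternMatrix D) (support D)
  patternMatrix-support D u w with support D u w
  ... | true  = (λ _ → 1≢0) , λ ()
  ... | false = (λ ()) , λ _ → refl

  patternMatrix-reverse : ∀ {n} (D : Digraph n) u w → patternMatrix (reverse D) u w ≡ patternMatrix D w u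
  patternMatrix-reverse D u w with u Fin.≟ w | w Fin.≟ u
  ... | yes _   | yes _   = refl
  ... | no  _   | no  _   = refl
  ... | yes u≡w | no  w≢u = contradiction (sym u≡w) w≢u
  ... | no  u≢w | yes w≡u = contradiction (sym w≡u) u≢w

  Q⇒nullity<n : ∀ {n} (D : Digraph (suc n)) B → InQ D B → ¬ NullityAtLeast (suc n) B
  Q⇒nullity<n D B (diagonal≢0 , _) = entry≢0⇒nullity<n B zero zero (diagonal≢0 zero)

  pattern-ASAP : ∀ {n} (D : Digraph (suc n)) t →
    {T ⌊ Fin.all? (λ u → Fin.all? λ w → T? (forcedZeros t (support D) u w)) ⌋} →
    ASAP (patternMatrix D)
  pattern-ASAP D t {allForced} = forcing⇒ASAP (patternMatrix-support D) t (toWitness allForced)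

  pattern-nullity : ∀ {k n} (D : Digraph n) (vs : Vec (Vec ℤ n) k) (ps : Vec (Fin n) k) →
    {T ⌊ isKernelBasis? (patternℤ D) (λ i → lookup (lookup vs i)) (lookup ps) ⌋} →
    NullityAtLeast k (patternMatrix D)
  pattern-nullity D vs ps {isBasis} =
    kernelBasis⇒nullity {A = patternℤ D} {v} {lookup ps} (toWitness isBasis)
    where
    v : Fin _ → Fin _ → ℤ
    v i = lookup (lookup vs i)

  pattern⇒ν≥ : ∀ {n k} (D : Digraph n) → ASAP (patternMatrix D) → NullityAtLeast k (patternMatrix D) →
               νAtLeast D k
  pattern⇒ν≥ D asap nullity = patternMatrix D , patternMatrix∈Q D , asap , nullity

mainTheorem8 : (R : RealField) → let open Matrices R in
    νEq K₃ 2 × νAtLeast N₄ 2 × νAtLeast M₅ 2 ×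
    νAtLeast (reverse N₄) 2 × νAtLeast (reverse M₅) 2
mainTheorem8 R =
  ((patternMatrix K₃ , patternMatrix∈Q K₃ , pattern-ASAP K₃ 0 , K₃-nullity ,
    Q⇒nullity<n K₃ _ (patternMatrix∈Q K₃)) ,
   λ B B∈Q _ → Q⇒nullity<n K₃ B B∈Q) ,
  pattern⇒ν≥ N₄ N₄-ASAP N₄-nullity ,
  pattern⇒ν≥ M₅ M₅-ASAP M₅-nullity ,
  pattern⇒ν≥ (reverse N₄) (ASAP-transpose (patternMatrix-reverse N₄) N₄-ASAP) N₄ᵀ-nullity ,
  pattern⇒ν≥ (reverse M₅) (ASAP-transpose (patternMatrix-reverse M₅) M₅-ASAP) M₅ᵀ-nullity
  where
  open Matrices R
  open ArnoldProperty R
  open PatternMatrices R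

  N₄-ASAP : ASAP (patternMatrix N₄)
  N₄-ASAP = pattern-ASAP N₄ 1

  M₅-ASAP : ASAP (patternMatrix M₅)
  M₅-ASAP = pattern-ASAP M₅ 2

  K₃-nullity : NullityAtLeast 2 (patternMatrix K₃)
  K₃-nullity = pattern-nullity K₃
    ( (1ℤ ∷ -1ℤ ∷ 0ℤ ∷ [])
    ∷ (0ℤ ∷ -1ℤ ∷ 1ℤ ∷ []) ∷ []) (0F ∷ 2F ∷ [])

  N₄-nullity : NullityAtLeast 2 (patternMatrix N₄)
  N₄-nullity = pattern-nullity N₄
    ( (1ℤ ∷ 0ℤ ∷ -1ℤ ∷ 1ℤ ∷ [])
    ∷ (0ℤ ∷ 1ℤ ∷ -1ℤ ∷ 0ℤ ∷ []) ∷ []) (0F ∷ 1F ∷ [])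

  M₅-nullity : NullityAtLeast 2 (patternMatrix M₅)
  M₅-nullity = pattern-nullity M₅
    ( (1ℤ ∷ 0ℤ ∷ -1ℤ ∷ 1ℤ ∷ 0ℤ ∷ [])
    ∷ (0ℤ ∷ 1ℤ ∷ -1ℤ ∷ 0ℤ ∷ 1ℤ ∷ []) ∷ []) (0F ∷ 1F ∷ [])

  N₄ᵀ-nullity : NullityAtLeast 2 (patternMatrix (reverse N₄))
  N₄ᵀ-nullity = pattern-nullity (reverse N₄)
    ( (1ℤ ∷ -1ℤ ∷ 0ℤ ∷ 0ℤ ∷ [])
    ∷ (0ℤ ∷ 0ℤ ∷ 1ℤ ∷ -1ℤ ∷ []) ∷ []) (0F ∷ 2F ∷ [])

  M₅ᵀ-nullity : NullityAtLeast 2 (patternMatrix (reverse M₅))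
  M₅ᵀ-nullity = pattern-nullity (reverse M₅)
    ( (1ℤ ∷ -1ℤ ∷ 0ℤ ∷ 0ℤ ∷ 0ℤ ∷ [])
    ∷ (0ℤ ∷ 0ℤ ∷ 0ℤ ∷ 1ℤ ∷ -1ℤ ∷ []) ∷ []) (0F ∷ 3F ∷ [])
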